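{- Let $q>p\ge 3$ be coprime integers. Let $\langle p,q\rangle=\{iq+jp : i,j\in\mathbb{Z},\ i,j\ge 0\}$, $\varphi(p,q)=(p-1)(q-1)$ and $\vartheta=\varphi(p,q)/2$. List the elements of $S(p,q)=\langle p,q\rangle\cap[0,\varphi(p,q)]$ increasingly as $\ell_0<\ell_1<\dots<\ell_\vartheta$, and list the positive integers not in $\langle p,q\rangle$ increasingly as $n_1<n_2<\dots<n_\vartheta$. Put $S_\Delta(p,q)=\{\ell_{j+1}-\ell_j : 0\le j\le \vartheta-1\}$ and $N_\Delta(p,q)=\{n_{j+1}-n_j : 1\le j\le\vartheta-1\}$. Define $r_0=p$, $r_1=\langle q\rangle_p$ (the least nonnegative residue of $q$ modulo $p$), and run the Euclidean algorithm: for $1\le i\le t$, $r_{i-1}=Z_ir_i+r_{i+1}$ with integers $Z_i$ and $0\le r_{i+1}<r_i$, where $t$ is the index with $r_t=1$ (so $r_{t+1}=0$). Then: (i) If $q\ne p+1$, then $S_\Delta(p,q)=N_\Delta(p,q)$. If $q=p+1$, then $S_\Delta(p,q)=N_\Delta(p,q)\cup\{2\}$ and $2\notin N_\Delta(p,q)$. (ii) $S_\Delta(p,q)=\{\,r_{i-1}-zr_i : 1\le i\le t,\ 0\le z\le Z_i-1\,\}$.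
   Context: It is known that the positive integers not in $\langle p,q\rangle$ are exactly $\vartheta$ in number, the largest being $pq-p-q$, and that $S(p,q)$ has exactly $\vartheta+1$ elements, with $\ell_0=0$ and $\ell_\vartheta=(p-1)(q-1)$. For an integer $x$, $\langle x\rangle_p$ denotes the unique integer with $\langle x\rangle_p\equiv x \pmod p$ and $0\le\langle x\rangle_p<p$. -}

module Defs where

open import Data.Nat using (ℕ; zero; suc; _+_; _*_; _∸_; _≤_; _<_; NonZero)
open import Data.Nat.DivMod using (_/_; _%_)
open import Data.Product using (Σ; ∃; _×_; _,_)
open import Data.Empty using (⊥)
open import Relation.Nullary using (¬_)
open import Relation.Binary.PropositionalEquality using (_≡_)

InSG : ℕ → ℕ → ℕ → Set
InSG p q n = ∃ λ i → ∃ λ j → i * q + j * p ≡ n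

φ : ℕ → ℕ → ℕ
φ p q = (p ∸ 1) * (q ∸ 1)

InS : ℕ → ℕ → ℕ → Set
InS p q n = InSG p q n × n ≤ φ p q

IsGap : ℕ → ℕ → ℕ → Set
IsGap p q n = 1 ≤ n × ¬ InSG p q n

Consecutive : (ℕ → Set) → ℕ → ℕ → Set
Consecutive P a b = P a × P b × a < b × (∀ c → P c → a < c → c < b → ⊥)

SΔ : ℕ → ℕ → ℕ → Set
SΔ p q d = ∃ λ a → ∃ λ b → Consecutive (InS p q) a b × d ≡ b ∸ a

NΔ : ℕ → ℕ → ℕ → Set
NΔ p q d = ∃ λ a → ∃ λ b → Consecutive (IsGap p q) a b × d ≡ b ∸ a

-- EuclidSet a b d : d ∈ { r_{i-1} - z r_i : 1 ≤ i ≤ t, 0 ≤ z ≤ Z_i - 1 }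
-- for the Euclidean remainder sequence r_0 = a, r_1 = b, r_{i+1} = r_{i-1} mod r_i,
-- Z_i = r_{i-1} / r_i, stopping when the remainder becomes 0.
data EuclidSet : ℕ → ℕ → ℕ → Set where
  here  : ∀ {a b d} z .{{_ : NonZero b}} → z < a / b → d ≡ a ∸ z * b → EuclidSet a b d
  there : ∀ {a b d} .{{_ : NonZero b}} → EuclidSet b (a % b) d → EuclidSet a b d

-- The reflection n ↦ F − n, where F = pq − p − q, exchanges the elements of ⟨p,q⟩ in [0, F] with
-- the gaps, so the consecutive differences of S(p,q) below F are exactly those of the gaps. The one
-- remaining pair of S(p,q) is (F − 1, F + 1), of difference 2, and 2 is a difference of consecutive
-- gaps iff p − 1 and p + 1 are gaps, i.e. iff q ≠ p + 1.
--
-- Write consecutive elements of S(p,q) as iq + jp and i′q + j′p with i, i′ < p. Their difference is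
-- p when i = i′, and otherwise X w or p − X w, where X v = vq mod p and w = |i − i′| is a lower or
-- upper record of X; conversely every record yields such a pair. Finally, the record distances of
-- v ↦ vb mod a are {a − zb : z < a / b} together with those of v ↦ v(a mod b) mod b, which is the
-- recursion that defines the Euclidean set.

module Submission where

open import Defs
open import Data.Nat using (ℕ; suc; _≤_; _<_; NonZero)
open import Data.Nat.DivMod using (_%_)
open import Data.Nat.Coprimality using (Coprime)
open import Data.Product using (_×_)
open import Data.Sum using (_⊎_)
open import Function.Bundles using (_⇔_)
open import Relation.Nullary using (¬_)
open import Relation.Binary.PropositionalEquality using (_≡_; _≢_)

open import Data.Empty
open import Data.Nat
open import Data.Nat.Coprimality using (coprime-Bézout; coprime-divisor)
import Data.Nat.Coprimality as Coprimality
open import Data.Nat.Divisibility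
open import Data.Nat.DivMod
open import Data.Nat.GCD using (module Bézout)
open import Data.Nat.Induction using (<-wellFounded)
open import Data.Nat.Properties
open import Data.Nat.Solver
open import Data.Product
open import Data.Sum
open import Data.Sum.Function.Propositional using (_⊎-⇔_)
open import Function.Base using (id; _∘_)
open import Function.Bundles using (mk⇔)
open import Function.Construct.Composition using (_⇔-∘_)
open import Function.Construct.Identity using (⇔-id)
open import Induction.WellFounded using (Acc; acc)
open import Relation.Binary.Definitions using (tri<; tri≈; tri>)
open import Relation.Binary.PropositionalEquality hiding ([_])
open import Relation.Nullary
open import Algebra.Properties.CommutativeSemigroup +-commutativeSemigroup using (xy∙z≈y∙xz; x∙yz≈y∙xz)
open +-*-Solver using (solve; _:+_; _:*_; _:=_; con)

*+-injective : ∀ {n} A B {x y} → x < n → y < n → A * n + x ≡ B * n + y → A ≡ B × x ≡ y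
*+-injective zero zero _ _ eq = refl , eq
*+-injective {n} zero (suc B) {x} {y} x<n _ eq =
  contradiction (subst (n ≤_) (sym eq) (≤-trans (m≤m+n n (B * n)) (m≤m+n _ y))) (<⇒≱ x<n)
*+-injective {n} (suc A) zero {x} {y} _ y<n eq =
  contradiction (subst (n ≤_) eq (≤-trans (m≤m+n n (A * n)) (m≤m+n _ x))) (<⇒≱ y<n)
*+-injective {n} (suc A) (suc B) {x} {y} x<n y<n eq
  with refl , x≡y ← *+-injective A B x<n y<n
         (+-cancelˡ-≡ n _ _ (trans (sym (+-assoc n (A * n) x)) (trans eq (+-assoc n (B * n) y))))
  = refl , x≡y

*+≡⇒%≡ : ∀ {m n} .{{_ : NonZero n}} k {x} → x < n → m ≡ k * n + x → m % n ≡ x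
*+≡⇒%≡ {m} {n} k x<n eq = proj₂ (*+-injective (m / n) k (m%n<n m n) x<n
  (trans (+-comm (m / n * n) (m % n)) (trans (sym (m≡m%n+[m/n]*n m n)) eq)))

*+<*⇒< : ∀ {n} A B x → A * n + x < B * n → A < B
*+<*⇒< {n} A B x lt = *-cancelʳ-< n A B (≤-<-trans (m≤m+n (A * n) x) lt)

*≤*+⇒≤ : ∀ {n} A B {y} → y < n → A * n ≤ B * n + y → A ≤ B
*≤*+⇒≤ {n} A B {y} y<n le = ≤-pred (*-cancelʳ-< n A (suc B) (begin-strict
  A * n     ≤⟨ le ⟩
  B * n + y <⟨ +-monoʳ-< (B * n) y<n ⟩
  B * n + n ≡⟨ +-comm (B * n) n ⟩
  suc B * n ∎))
  where open ≤-Reasoning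

*+<*+⇒lex< : ∀ {n} A B {x y} → x < n → y < n → A * n + x < B * n + y → A < B ⊎ (A ≡ B × x < y)
*+<*+⇒lex< {n} A B {x} {y} x<n y<n lt with m≤n⇒m<n∨m≡n (*≤*+⇒≤ A B y<n (<⇒≤ (≤-<-trans (m≤m+n (A * n) x) lt)))
... | inj₁ A<B  = inj₁ A<B
... | inj₂ refl = inj₂ (refl , +-cancelˡ-< (A * n) x y lt)

residues-sum-to-modulus : ∀ {n} A B {x y} → 0 < x → x < n → y ≤ n → A * n + (x + y) ≡ B * n → x + y ≡ n
residues-sum-to-modulus {n} A B {x} {y} 0<x x<n y≤n eq with x + y <? n
... | yes x+y<n = contradiction (proj₂ (*+-injective A B x+y<n (<-trans 0<x x<n) (trans eq (sym (+-identityʳ _)))))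
                    (>⇒≢ (≤-trans 0<x (m≤m+n x y)))
... | no x+y≮n = overflow (m≤n⇒∃[o]m+o≡n (≮⇒≥ x+y≮n))
  where
  0<n : 0 < n
  0<n = <-trans 0<x x<n
  overflow : ∃ (λ k → n + k ≡ x + y) → x + y ≡ n
  overflow (k , n+k≡) = trans (sym n+k≡) (trans (cong (n +_) k≡0) (+-identityʳ n))
    where
    k<n : k < n
    k<n = +-cancelˡ-< n k n (subst (_< n + n) (sym n+k≡) (+-mono-<-≤ x<n y≤n))
    k≡0 : k ≡ 0
    k≡0 = proj₂ (*+-injective (suc A) B k<n 0<n (begin
      (n + A * n) + k ≡⟨ xy∙z≈y∙xz n (A * n) k ⟩
      A * n + (n + k) ≡⟨ cong (A * n +_) n+k≡ ⟩
      A * n + (x + y) ≡⟨ eq ⟩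
      B * n           ≡⟨ +-identityʳ (B * n) ⟨
      B * n + 0       ∎))
      where open ≡-Reasoning

m<n⇒∃[o]0<o×m+o≡n : ∀ {m n} → m < n → ∃ λ o → 0 < o × m + o ≡ n
m<n⇒∃[o]0<o×m+o≡n {m} {n} m<n = n ∸ m , m<n⇒0<n∸m m<n , m+[n∸m]≡n (<⇒≤ m<n)

m+n≡o+p⇒m<o⇒p<n : ∀ {m n o p} → m + n ≡ o + p → m < o → p < n
m+n≡o+p⇒m<o⇒p<n {m} {n} {o} {p} eq m<o = ≰⇒> (λ n≤p → <-irrefl eq (+-mono-<-≤ m<o n≤p))

coprime-% : ∀ {a b} .{{_ : NonZero b}} → Coprime a b → Coprime b (a % b)
coprime-% coprime (d∣b , d∣r) = coprime (∣n∣m%n⇒∣m d∣b d∣r , d∣b)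

coprime⇒%>0 : ∀ {a b} .{{_ : NonZero b}} → Coprime a b → 1 < b → 0 < a % b
coprime⇒%>0 {a} {b} coprime 1<b with a % b in r≡0
... | suc _ = z<s
... | zero  = contradiction (coprime (m%n≡0⇒n∣m a b r≡0 , ∣-refl)) (>⇒≢ 1<b)

module Residues (a b : ℕ) .{{_ : NonZero a}} where

  res : ℕ → ℕ
  res v = v * b % a

  quo : ℕ → ℕ
  quo v = v * b / a

  quo-res : ∀ v → v * b ≡ quo v * a + res v
  quo-res v = trans (m≡m%n+[m/n]*n (v * b) a) (+-comm (res v) (quo v * a))

  res-bound : ∀ v → res v < a
  res-bound v = m%n<n (v * b) a

  res-unique : ∀ v k {x} → x < a → v * b ≡ k * a + x → res v ≡ x
  res-unique v k = *+≡⇒%≡ k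

  quo-mono : ∀ {v w} → v ≤ w → quo v ≤ quo w
  quo-mono v≤w = /-monoˡ-≤ a (*-monoˡ-≤ b v≤w)

  res-shift : ∀ i v j → (i + v) * b + j * a ≡ i * b + (quo v + j) * a + res v
  res-shift i v j = begin
    (i + v) * b + j * a                 ≡⟨ solve 5 (λ i v b j a → (i :+ v) :* b :+ j :* a := i :* b :+ v :* b :+ j :* a) refl i v b j a ⟩
    i * b + v * b + j * a               ≡⟨ cong (λ x → i * b + x + j * a) (quo-res v) ⟩
    i * b + (quo v * a + res v) + j * a ≡⟨ solve 6 (λ i b K a R j → i :* b :+ (K :* a :+ R) :+ j :* a := i :* b :+ (K :+ j) :* a :+ R) refl i b (quo v) a (res v) j ⟩
    i * b + (quo v + j) * a + res v     ∎
    where open ≡-Reasoning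

  res-shift-≤ : ∀ i j {v w} → v ≤ w → ∃ λ j′ → (i + v) * b + j′ * a ≡ i * b + (quo w + j) * a + res v
  res-shift-≤ i j {v} {w} v≤w with δ , Kv+δ≡Kw ← m≤n⇒∃[o]m+o≡n (quo-mono v≤w) = δ + j , (begin
    (i + v) * b + (δ + j) * a             ≡⟨ res-shift i v (δ + j) ⟩
    i * b + (quo v + (δ + j)) * a + res v ≡⟨ cong (λ k → i * b + k * a + res v) (trans (sym (+-assoc (quo v) δ j)) (cong (_+ j) Kv+δ≡Kw)) ⟩
    i * b + (quo w + j) * a + res v       ∎)
    where open ≡-Reasoning

  module _ (coprime : Coprime a b) where

    a∤*b : ∀ {e} → 0 < e → e < a → ¬ (a ∣ e * b)
    a∤*b {e} 0<e e<a a∣eb = <⇒≱ e<a (∣⇒≤ {{>-nonZero 0<e}} (coprime-divisor coprime (subst (a ∣_) (*-comm e b) a∣eb)))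

    res>0 : ∀ {v} → 0 < v → v < a → 0 < res v
    res>0 {v} 0<v v<a with res v in eq
    ... | suc _ = z<s
    ... | zero  = contradiction (m%n≡0⇒n∣m (v * b) a eq) (a∤*b 0<v v<a)

    res-injective : ∀ {v w} → v < w → w < a → res v ≢ res w
    res-injective {v} {w} v<w w<a resv≡resw with e , refl ← m≤n⇒∃[o]m+o≡n v<w =
      a∤*b {suc e} z<s (≤-<-trans (s≤s (m≤n+m e v)) w<a)
        (∣m+n∣m⇒∣n (subst (a ∣_) (sym split) (n∣m*n (quo w))) (n∣m*n (quo v)))
      where
      open ≡-Reasoning
      split : quo v * a + suc e * b ≡ quo w * a
      split = +-cancelʳ-≡ (res v) _ _ (begin
        quo v * a + suc e * b + res v   ≡⟨ xy∙z≈y∙xz (quo v * a) (suc e * b) (res v) ⟩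
        suc e * b + (quo v * a + res v) ≡⟨ cong (suc e * b +_) (quo-res v) ⟨
        suc e * b + v * b               ≡⟨ *-distribʳ-+ b (suc e) v ⟨
        (suc e + v) * b                 ≡⟨ cong (λ k → suc k * b) (+-comm e v) ⟩
        suc (v + e) * b                 ≡⟨ quo-res (suc (v + e)) ⟩
        quo w * a + res w               ≡⟨ cong (quo w * a +_) resv≡resw ⟨
        quo w * a + res v               ∎)

res-mod : ∀ a b .{{_ : NonZero a}} v → Residues.res a b v ≡ Residues.res a (b % a) v
res-mod a b v = begin
  v * b % a                           ≡⟨ cong (λ c → v * c % a) (m≡m%n+[m/n]*n b a) ⟩
  v * (b % a + b / a * a) % a         ≡⟨ cong (_% a) (trans (*-distribˡ-+ v (b % a) (b / a * a)) (cong (v * (b % a) +_) (sym (*-assoc v (b / a) a)))) ⟩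
  (v * (b % a) + v * (b / a) * a) % a ≡⟨ [m+kn]%n≡m%n (v * (b % a)) (v * (b / a)) a ⟩
  v * (b % a) % a                     ∎
  where open ≡-Reasoning

LowerRecord : (ℕ → ℕ) → ℕ → Set
LowerRecord f w = ∀ v → 0 < v → v < w → f w < f v

lower-record-1 : ∀ {f} → LowerRecord f 1
lower-record-1 _ 0<v v<1 = contradiction 0<v (<⇒≱ v<1)

UpperRecord : (ℕ → ℕ) → ℕ → Set
UpperRecord f w = ∀ v → 0 < v → v < w → f v < f w

-- modulus and unit are the first and the last entry, r₀ − 0·r₁ and r_{t−1} − (Z_t − 1)·r_t, of the
-- Euclidean set.
data RecordDistance (a : ℕ) (f : ℕ → ℕ) : ℕ → Set where
  modulus : RecordDistance a f a
  unit    : RecordDistance a f 1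
  lower   : ∀ {w} → 0 < w → w < a → LowerRecord f w → RecordDistance a f (f w)
  upper   : ∀ {w} → 0 < w → w < a → UpperRecord f w → RecordDistance a f (a ∸ f w)

record-distance-resp : ∀ {a f g} → (∀ v → f v ≡ g v) → ∀ {d} → RecordDistance a f d → RecordDistance a g d
record-distance-resp f≗g modulus = modulus
record-distance-resp f≗g unit    = unit
record-distance-resp {a} {f} {g} f≗g (lower {w} 0<w w<a low) =
  subst (RecordDistance a g) (sym (f≗g w)) (lower 0<w w<a (λ v 0<v v<w → subst₂ _<_ (f≗g w) (f≗g v) (low v 0<v v<w)))
record-distance-resp {a} {f} {g} f≗g (upper {w} 0<w w<a up) =
  subst (RecordDistance a g) (cong (a ∸_) (sym (f≗g w))) (upper 0<w w<a (λ v 0<v v<w → subst₂ _<_ (f≗g v) (f≗g w) (up v 0<v v<w)))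

record-distance-cong : ∀ {a f g} → (∀ v → f v ≡ g v) → ∀ {d} → RecordDistance a f d ⇔ RecordDistance a g d
record-distance-cong f≗g = mk⇔ (record-distance-resp f≗g) (record-distance-resp (λ v → sym (f≗g v)))

EuclidRow : ℕ → (b : ℕ) → .{{NonZero b}} → ℕ → Set
EuclidRow a b d = ∃ λ z → z < a / b × d ≡ a ∸ z * b

-- With r = a % b, write X v = v b mod a, K v = ⌊v b / a⌋ and Y k = k r mod b = k a mod b.
-- Lower records w > 1 of X correspond to upper records K w of Y (inverse k ↦ above k), upper
-- records w ≥ a / b of X to lower records K w + 1 of Y (inverse k ↦ below k), and the upper
-- records w < a / b of X are the multiples w b < a.
module EuclidStep (a b : ℕ) .{{_ : NonZero a}} .{{_ : NonZero b}} (coprime : Coprime a b) (1<b : 1 < b) (b<a : b < a) where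

  private
    r : ℕ
    r = a % b
    Z : ℕ
    Z = a / b
    module A = Residues a b
    module B = Residues b r
    open A using () renaming (res to X; quo to K)
    open B using () renaming (res to Y)

  Zb+r≡a : Z * b + r ≡ a
  Zb+r≡a = sym (trans (m≡m%n+[m/n]*n a b) (+-comm r (Z * b)))

  Y>0 : ∀ {k} → 0 < k → k < b → 0 < Y k
  Y>0 = B.res>0 (coprime-% coprime)

  Zb<a : Z * b < a
  Zb<a = subst (Z * b <_) Zb+r≡a (m<m+n (Z * b) (coprime⇒%>0 coprime 1<b))

  X≡*b : ∀ v → v * b < a → X v ≡ v * b
  X≡*b v vb<a = A.res-unique v 0 vb<a refl

  X1≡b : X 1 ≡ b
  X1≡b = trans (X≡*b 1 (subst (_< a) (sym (*-identityˡ b)) b<a)) (*-identityˡ b)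

  below : ℕ → ℕ
  below k = k * Z + B.quo k

  above : ℕ → ℕ
  above k = suc (below k)

  below-*b+Y≡*a : ∀ k → below k * b + Y k ≡ k * a
  below-*b+Y≡*a k = begin
    (k * Z + B.quo k) * b + Y k       ≡⟨ solve 5 (λ k Z Q b y → (k :* Z :+ Q) :* b :+ y := k :* (Z :* b) :+ (Q :* b :+ y)) refl k Z (B.quo k) b (Y k) ⟩
    k * (Z * b) + (B.quo k * b + Y k) ≡⟨ cong (k * (Z * b) +_) (B.quo-res k) ⟨
    k * (Z * b) + k * r               ≡⟨ *-distribˡ-+ k (Z * b) r ⟨
    k * (Z * b + r)                   ≡⟨ cong (k *_) Zb+r≡a ⟩
    k * a                             ∎
    where open ≡-Reasoning

  above-*b≡ : ∀ {k} → k < b → above k * b ≡ k * a + (b ∸ Y k)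
  above-*b≡ {k} k<b = +-cancelʳ-≡ (Y k) _ _ (begin
    (b + below k * b) + Y k ≡⟨ +-assoc b (below k * b) (Y k) ⟩
    b + (below k * b + Y k) ≡⟨ cong (b +_) (below-*b+Y≡*a k) ⟩
    b + k * a               ≡⟨ +-comm b (k * a) ⟩
    k * a + b               ≡⟨ cong (k * a +_) (m∸n+n≡m (<⇒≤ (B.res-bound k))) ⟨
    k * a + (b ∸ Y k + Y k) ≡⟨ +-assoc (k * a) (b ∸ Y k) (Y k) ⟨
    k * a + (b ∸ Y k) + Y k ∎)
    where open ≡-Reasoning

  X-above : ∀ {k} → k < b → X (above k) ≡ b ∸ Y k
  X-above {k} k<b = A.res-unique (above k) k (≤-<-trans (m∸n≤m b (Y k)) b<a) (above-*b≡ k<b)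

  below-*b≡ : ∀ {k} → 0 < k → k < b → below k * b ≡ (k ∸ 1) * a + (a ∸ Y k)
  below-*b≡ {suc k} 0<k k<b = +-cancelʳ-≡ (Y (suc k)) _ _ (begin
    below (suc k) * b + Y (suc k)       ≡⟨ below-*b+Y≡*a (suc k) ⟩
    a + k * a                           ≡⟨ +-comm a (k * a) ⟩
    k * a + a                           ≡⟨ cong (k * a +_) (m∸n+n≡m Yk≤a) ⟨
    k * a + (a ∸ Y (suc k) + Y (suc k)) ≡⟨ +-assoc (k * a) _ (Y (suc k)) ⟨
    k * a + (a ∸ Y (suc k)) + Y (suc k) ∎)
    where
    open ≡-Reasoning
    Yk≤a : Y (suc k) ≤ a
    Yk≤a = <⇒≤ (<-trans (B.res-bound (suc k)) b<a)

  X-below : ∀ {k} → 0 < k → k < b → X (below k) ≡ a ∸ Y k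
  X-below {k} 0<k k<b = A.res-unique (below k) (k ∸ 1) (∸-monoʳ-< (Y>0 0<k k<b) (<⇒≤ (<-trans (B.res-bound k) b<a))) (below-*b≡ 0<k k<b)

  quo<b : ∀ {w} → w < a → K w < b
  quo<b {w} w<a = *-cancelʳ-< a (K w) b (begin-strict
    K w * a       ≤⟨ m≤m+n (K w * a) (X w) ⟩
    K w * a + X w ≡⟨ A.quo-res w ⟨
    w * b         <⟨ *-monoˡ-< b w<a ⟩
    a * b         ≡⟨ *-comm a b ⟩
    b * a         ∎)
    where open ≤-Reasoning

  quo>0 : ∀ {w} → 0 < w → X w < b → 0 < K w
  quo>0 {w} 0<w Xw<b with K w in Kw≡0
  ... | suc _ = z<s
  ... | zero  = contradiction (subst (b ≤_) wb≡Xw (subst (_≤ w * b) (*-identityˡ b) (*-monoˡ-≤ b 0<w))) (<⇒≱ Xw<b)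
    where
    wb≡Xw : w * b ≡ X w
    wb≡Xw = trans (A.quo-res w) (cong (λ k → k * a + X w) Kw≡0)

  Y-quo : ∀ {w} → 0 < w → w < a → X w < b → Y (K w) ≡ b ∸ X w
  Y-quo {w} 0<w w<a Xw<b = trans (sym (m+n∸n≡m (Y (K w)) (X w))) (cong (_∸ X w) Y+X≡b)
    where
    Y+X≡b : Y (K w) + X w ≡ b
    Y+X≡b = residues-sum-to-modulus (below (K w)) w (Y>0 (quo>0 0<w Xw<b) (quo<b w<a)) (B.res-bound (K w)) (<⇒≤ Xw<b) (begin
      below (K w) * b + (Y (K w) + X w) ≡⟨ +-assoc (below (K w) * b) (Y (K w)) (X w) ⟨
      below (K w) * b + Y (K w) + X w   ≡⟨ cong (_+ X w) (below-*b+Y≡*a (K w)) ⟩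
      K w * a + X w                     ≡⟨ A.quo-res w ⟨
      w * b                             ∎)
      where open ≡-Reasoning

  module _ {w} (w<a : w < a) (a<X+b : a < X w + b) where

    private
      t : ℕ
      t = X w + b ∸ a

      a+t≡X+b : a + t ≡ X w + b
      a+t≡X+b = m+[n∸m]≡n (<⇒≤ a<X+b)

      t<b : t < b
      t<b = m+n≡o+p⇒m<o⇒p<n (sym a+t≡X+b) (A.res-bound w)

      suc-quo-*a : suc (K w) * a + t ≡ suc w * b
      suc-quo-*a = begin
        (a + K w * a) + t   ≡⟨ xy∙z≈y∙xz a (K w * a) t ⟩
        K w * a + (a + t)   ≡⟨ cong (K w * a +_) a+t≡X+b ⟩
        K w * a + (X w + b) ≡⟨ +-assoc (K w * a) (X w) b ⟨
        K w * a + X w + b   ≡⟨ cong (_+ b) (A.quo-res w) ⟨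
        w * b + b           ≡⟨ +-comm (w * b) b ⟩
        b + w * b           ∎
        where open ≡-Reasoning

    suc-quo<b : suc (K w) < b
    suc-quo<b = *-cancelʳ-< a (suc (K w)) b (begin-strict
      suc (K w) * a     <⟨ m<m+n (suc (K w) * a) (m<n⇒0<n∸m a<X+b) ⟩
      suc (K w) * a + t ≡⟨ suc-quo-*a ⟩
      suc w * b         ≤⟨ *-monoˡ-≤ b w<a ⟩
      a * b             ≡⟨ *-comm a b ⟩
      b * a             ∎)
      where open ≤-Reasoning

    Y-suc-quo : Y (suc (K w)) ≡ a ∸ X w
    Y-suc-quo = trans (sym (m+n∸n≡m (Y j) (X w))) (cong (_∸ X w) (+-cancelʳ-≡ b _ _ (begin
      Y j + X w + b   ≡⟨ +-assoc (Y j) (X w) b ⟩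
      Y j + (X w + b) ≡⟨ cong (Y j +_) a+t≡X+b ⟨
      Y j + (a + t)   ≡⟨ x∙yz≈y∙xz (Y j) a t ⟩
      a + (Y j + t)   ≡⟨ cong (a +_) Y+t≡b ⟩
      a + b           ∎)))
      where
      open ≡-Reasoning
      j : ℕ
      j = suc (K w)
      Y+t≡b : Y j + t ≡ b
      Y+t≡b = residues-sum-to-modulus (below j) (suc w) (Y>0 z<s suc-quo<b) (B.res-bound j) (<⇒≤ t<b) (begin
        below j * b + (Y j + t) ≡⟨ +-assoc (below j * b) (Y j) t ⟨
        below j * b + Y j + t   ≡⟨ cong (_+ t) (below-*b+Y≡*a j) ⟩
        j * a + t               ≡⟨ suc-quo-*a ⟩
        suc w * b               ∎)

  below>0 : ∀ {k} → 0 < k → 0 < below k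
  below>0 {k} 0<k = ≤-trans (*-mono-≤ 0<k (m≥n⇒m/n>0 (<⇒≤ b<a))) (m≤m+n (k * Z) (B.quo k))

  lowerX⇒upperY : ∀ {w} → 1 < w → w < a → LowerRecord X w → RecordDistance b Y (X w)
  lowerX⇒upperY {w} 1<w w<a low = subst (RecordDistance b Y) b∸Yk≡Xw (upper (quo>0 0<w Xw<b) k<b up)
    where
    k : ℕ
    k = K w
    0<w : 0 < w
    0<w = <-trans z<s 1<w
    k<b : k < b
    k<b = quo<b w<a
    Xw<b : X w < b
    Xw<b = subst (X w <_) X1≡b (low 1 z<s 1<w)
    b∸Yk≡Xw : b ∸ Y k ≡ X w
    b∸Yk≡Xw = trans (cong (b ∸_) (Y-quo 0<w w<a Xw<b)) (m∸[m∸n]≡n (<⇒≤ Xw<b))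
    up : UpperRecord Y k
    up j 0<j j<k = ≰⇒> (λ Yk≤Yj → <⇒≱ (low (above j) z<s above<w) (X-above≤Xw Yk≤Yj))
      where
      j<b : j < b
      j<b = <-trans j<k k<b
      X-above≤Xw : Y k ≤ Y j → X (above j) ≤ X w
      X-above≤Xw Yk≤Yj = begin
        X (above j) ≡⟨ X-above j<b ⟩
        b ∸ Y j     ≤⟨ ∸-monoʳ-≤ b Yk≤Yj ⟩
        b ∸ Y k     ≡⟨ b∸Yk≡Xw ⟩
        X w         ∎
        where open ≤-Reasoning
      above<w : above j < w
      above<w = *-cancelʳ-< b (above j) w (begin-strict
        above j * b       ≡⟨ above-*b≡ j<b ⟩
        j * a + (b ∸ Y j) <⟨ +-monoʳ-< (j * a) (≤-<-trans (m∸n≤m b (Y j)) b<a) ⟩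
        j * a + a         ≡⟨ +-comm (j * a) a ⟩
        suc j * a         ≤⟨ *-monoˡ-≤ a j<k ⟩
        k * a             ≤⟨ m≤m+n (k * a) (X w) ⟩
        k * a + X w       ≡⟨ A.quo-res w ⟨
        w * b             ∎)
        where open ≤-Reasoning

  upperX⇒lowerY : ∀ {w} → Z ≤ w → w < a → UpperRecord X w → RecordDistance b Y (a ∸ X w)
  upperX⇒lowerY {w} Z≤w w<a up = subst (RecordDistance b Y) (Y-suc-quo w<a a<X+b) (lower z<s (suc-quo<b w<a a<X+b) low)
    where
    Zb≤Xw : Z * b ≤ X w
    Zb≤Xw with m≤n⇒m<n∨m≡n Z≤w
    ... | inj₁ Z<w  = subst (_≤ X w) (X≡*b Z Zb<a) (<⇒≤ (up Z (m≥n⇒m/n>0 (<⇒≤ b<a)) Z<w))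
    ... | inj₂ refl = ≤-reflexive (sym (X≡*b Z Zb<a))
    a<X+b : a < X w + b
    a<X+b = subst (_< X w + b) Zb+r≡a (+-mono-≤-< Zb≤Xw (m%n<n a b))
    low : LowerRecord Y (suc (K w))
    low j 0<j j<k = ≰⇒> (λ Yj≤Yk → <⇒≱ (up (below j) (below>0 0<j) below<w) (Xw≤X-below Yj≤Yk))
      where
      j<b : j < b
      j<b = <-trans j<k (suc-quo<b w<a a<X+b)
      Xw≤X-below : Y j ≤ Y (suc (K w)) → X w ≤ X (below j)
      Xw≤X-below Yj≤Yk = begin
        X w               ≡⟨ m∸[m∸n]≡n (<⇒≤ (A.res-bound w)) ⟨
        a ∸ (a ∸ X w)     ≡⟨ cong (a ∸_) (Y-suc-quo w<a a<X+b) ⟨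
        a ∸ Y (suc (K w)) ≤⟨ ∸-monoʳ-≤ a Yj≤Yk ⟩
        a ∸ Y j           ≡⟨ X-below 0<j j<b ⟨
        X (below j)       ∎
        where open ≤-Reasoning
      below<w : below j < w
      below<w = *-cancelʳ-< b (below j) w (begin-strict
        below j * b       <⟨ m<m+n (below j * b) (Y>0 0<j j<b) ⟩
        below j * b + Y j ≡⟨ below-*b+Y≡*a j ⟩
        j * a             ≤⟨ *-monoˡ-≤ a (≤-pred j<k) ⟩
        K w * a           ≤⟨ m≤m+n (K w * a) (X w) ⟩
        K w * a + X w     ≡⟨ A.quo-res w ⟨
        w * b             ∎)
        where open ≤-Reasoning

  upperY⇒lowerX : ∀ {k} → 0 < k → k < b → UpperRecord Y k → RecordDistance a X (b ∸ Y k)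
  upperY⇒lowerX {k} 0<k k<b up = subst (RecordDistance a X) (X-above k<b) (lower z<s above<a low)
    where
    w : ℕ
    w = above k
    above<a : w < a
    above<a = *-cancelʳ-< b w a (begin-strict
      w * b             ≡⟨ above-*b≡ k<b ⟩
      k * a + (b ∸ Y k) <⟨ +-monoʳ-< (k * a) (≤-<-trans (m∸n≤m b (Y k)) b<a) ⟩
      k * a + a         ≡⟨ +-comm (k * a) a ⟩
      suc k * a         ≤⟨ *-monoˡ-≤ a k<b ⟩
      b * a             ≡⟨ *-comm b a ⟩
      a * b             ∎)
      where open ≤-Reasoning
    low : LowerRecord X w
    low v 0<v v<w = ≰⇒> (λ Xv≤Xw → <⇒≱ (up (K v) (quo>0 0<v (Xv<b Xv≤Xw)) Kv<k) (Yk≤Y-quo Xv≤Xw))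
      where
      Xv<b : X v ≤ X w → X v < b
      Xv<b Xv≤Xw = ≤-<-trans Xv≤Xw (subst (_< b) (sym (X-above k<b)) (∸-monoʳ-< (Y>0 0<k k<b) (<⇒≤ (B.res-bound k))))
      Yk≤Y-quo : X v ≤ X w → Y k ≤ Y (K v)
      Yk≤Y-quo Xv≤Xw = begin
        Y k           ≡⟨ m∸[m∸n]≡n (<⇒≤ (B.res-bound k)) ⟨
        b ∸ (b ∸ Y k) ≡⟨ cong (b ∸_) (X-above k<b) ⟨
        b ∸ X w       ≤⟨ ∸-monoʳ-≤ b Xv≤Xw ⟩
        b ∸ X v       ≡⟨ Y-quo 0<v (<-trans v<w above<a) (Xv<b Xv≤Xw) ⟨
        Y (K v)       ∎
        where open ≤-Reasoning
      Kv<k : K v < k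
      Kv<k = *-cancelʳ-< a (K v) k (begin-strict
        K v * a               ≤⟨ m≤m+n (K v * a) (X v) ⟩
        K v * a + X v         ≡⟨ A.quo-res v ⟨
        v * b                 <⟨ +-cancelʳ-< b (v * b) (k * a) (begin-strict
            v * b + b         ≡⟨ +-comm (v * b) b ⟩
            suc v * b         ≤⟨ *-monoˡ-≤ b v<w ⟩
            w * b             ≡⟨ above-*b≡ k<b ⟩
            k * a + (b ∸ Y k) <⟨ +-monoʳ-< (k * a) (∸-monoʳ-< (Y>0 0<k k<b) (<⇒≤ (B.res-bound k))) ⟩
            k * a + b         ∎) ⟩
        k * a           ∎)
        where open ≤-Reasoning

  lowerY⇒upperX : ∀ {k} → 0 < k → k < b → LowerRecord Y k → RecordDistance a X (Y k)
  lowerY⇒upperX {k} 0<k k<b low = subst (RecordDistance a X) a∸Xw≡Yk (upper (below>0 0<k) below<a up)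
    where
    w : ℕ
    w = below k
    Yk≤a : Y k ≤ a
    Yk≤a = <⇒≤ (<-trans (B.res-bound k) b<a)
    a∸Xw≡Yk : a ∸ X w ≡ Y k
    a∸Xw≡Yk = trans (cong (a ∸_) (X-below 0<k k<b)) (m∸[m∸n]≡n Yk≤a)
    below<a : w < a
    below<a = *-cancelʳ-< b w a (begin-strict
      w * b       ≤⟨ m≤m+n (w * b) (Y k) ⟩
      w * b + Y k ≡⟨ below-*b+Y≡*a k ⟩
      k * a       <⟨ *-monoˡ-< a k<b ⟩
      b * a       ≡⟨ *-comm b a ⟩
      a * b       ∎)
      where open ≤-Reasoning
    up : UpperRecord X w
    up v 0<v v<w = ≰⇒> (λ Xw≤Xv → <⇒≱ (low (suc (K v)) z<s (j<k Xw≤Xv)) (Y-suc-quo≤Yk Xw≤Xv))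
      where
      v<a : v < a
      v<a = <-trans v<w below<a
      a<X+b : X w ≤ X v → a < X v + b
      a<X+b Xw≤Xv = begin-strict
        a             ≡⟨ m∸n+n≡m Yk≤a ⟨
        a ∸ Y k + Y k ≡⟨ cong (_+ Y k) (X-below 0<k k<b) ⟨
        X w + Y k     <⟨ +-mono-≤-< Xw≤Xv (B.res-bound k) ⟩
        X v + b       ∎
        where open ≤-Reasoning
      Y-suc-quo≤Yk : X w ≤ X v → Y (suc (K v)) ≤ Y k
      Y-suc-quo≤Yk Xw≤Xv = begin
        Y (suc (K v)) ≡⟨ Y-suc-quo v<a (a<X+b Xw≤Xv) ⟩
        a ∸ X v       ≤⟨ ∸-monoʳ-≤ a Xw≤Xv ⟩
        a ∸ X w       ≡⟨ a∸Xw≡Yk ⟩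
        Y k           ∎
        where open ≤-Reasoning
      j<k : X w ≤ X v → suc (K v) < k
      j<k Xw≤Xv = *-cancelʳ-< a (suc (K v)) k (begin-strict
        a + K v * a         <⟨ +-monoˡ-< (K v * a) (a<X+b Xw≤Xv) ⟩
        (X v + b) + K v * a ≡⟨ solve 3 (λ x b y → (x :+ b) :+ y := b :+ (y :+ x)) refl (X v) b (K v * a) ⟩
        b + (K v * a + X v) ≡⟨ cong (b +_) (A.quo-res v) ⟨
        suc v * b           ≤⟨ *-monoˡ-≤ b v<w ⟩
        w * b               ≤⟨ m≤m+n (w * b) (Y k) ⟩
        w * b + Y k         ≡⟨ below-*b+Y≡*a k ⟩
        k * a               ∎)
        where open ≤-Reasoning

  small-multiple-upper : ∀ {w} → 0 < w → w < Z → RecordDistance a X (a ∸ w * b)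
  small-multiple-upper {w} 0<w w<Z =
    subst (RecordDistance a X) (cong (a ∸_) (X≡*b w wb<a)) (upper 0<w (≤-<-trans (m≤m*n w b) wb<a) up)
    where
    wb<a : w * b < a
    wb<a = <-trans (*-monoˡ-< b w<Z) Zb<a
    up : UpperRecord X w
    up v _ v<w = subst₂ _<_ (sym (X≡*b v vb<a)) (sym (X≡*b w wb<a)) (*-monoˡ-< b v<w)
      where
      vb<a : v * b < a
      vb<a = <-trans (*-monoˡ-< b v<w) wb<a

  euclid-step : ∀ {d} → RecordDistance a X d ⇔ (EuclidRow a b d ⊎ RecordDistance b Y d)
  euclid-step = mk⇔ to from
    where
    to : ∀ {d} → RecordDistance a X d → EuclidRow a b d ⊎ RecordDistance b Y d
    to modulus = inj₁ (0 , m≥n⇒m/n>0 (<⇒≤ b<a) , refl)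
    to unit    = inj₂ unit
    to (lower {w} 0<w w<a low) with m≤n⇒m<n∨m≡n 0<w
    ... | inj₁ 1<w  = inj₂ (lowerX⇒upperY 1<w w<a low)
    ... | inj₂ refl = inj₂ (subst (RecordDistance b Y) (sym X1≡b) modulus)
    to (upper {w} 0<w w<a up) with w <? Z
    ... | yes w<Z = inj₁ (w , w<Z , cong (a ∸_) (X≡*b w (<-trans (*-monoˡ-< b w<Z) Zb<a)))
    ... | no w≮Z  = inj₂ (upperX⇒lowerY (≮⇒≥ w≮Z) w<a up)
    from : ∀ {d} → EuclidRow a b d ⊎ RecordDistance b Y d → RecordDistance a X d
    from (inj₁ (zero , _ , refl))      = modulus
    from (inj₁ (suc z , z<Z , refl))   = small-multiple-upper z<s z<Z
    from (inj₂ modulus)                = subst (RecordDistance a X) X1≡b (lower z<s (<-trans 1<b b<a) lower-record-1)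
    from (inj₂ unit)                   = unit
    from (inj₂ (lower 0<k k<b low))    = lowerY⇒upperX 0<k k<b low
    from (inj₂ (upper 0<k k<b up))     = upperY⇒lowerX 0<k k<b up

euclid-set-unfold : ∀ a b .{{_ : NonZero b}} {d} → (EuclidRow a b d ⊎ EuclidSet b (a % b) d) ⇔ EuclidSet a b d
euclid-set-unfold a b = mk⇔ fold unfold
  where
  fold : ∀ {d} → EuclidRow a b d ⊎ EuclidSet b (a % b) d → EuclidSet a b d
  fold (inj₁ (z , z<a/b , d≡)) = here z z<a/b d≡
  fold (inj₂ e)                = there e
  unfold : ∀ {d} → EuclidSet a b d → EuclidRow a b d ⊎ EuclidSet b (a % b) d
  unfold (here z z<a/b d≡) = inj₁ (z , z<a/b , d≡)
  unfold (there e)         = inj₂ e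

euclid-set-1-0 : ∀ {d} → ¬ EuclidSet 1 0 d
euclid-set-1-0 (here _ {{()}} _ _)
euclid-set-1-0 (there {{()}} _)

record-distance⇔euclid-set-1 : ∀ a .{{_ : NonZero a}} → 1 < a → ∀ {d} → RecordDistance a (Residues.res a 1) d ⇔ EuclidSet a 1 d
record-distance⇔euclid-set-1 a 1<a = mk⇔ to from
  where
  open Residues a 1 using (res)
  res≡id : ∀ {v} → v < a → res v ≡ v
  res≡id {v} v<a = trans (cong (_% a) (*-identityʳ v)) (m<n⇒m%n≡m v<a)
  in-range : ∀ {d} → 0 < d → d ≤ a → EuclidSet a 1 d
  in-range {d} 0<d d≤a = here (a ∸ d) (subst (a ∸ d <_) (sym (n/1≡n a)) (∸-monoʳ-< 0<d d≤a))
    (sym (trans (cong (a ∸_) (*-identityʳ (a ∸ d))) (m∸[m∸n]≡n d≤a)))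
  to : ∀ {d} → RecordDistance a res d → EuclidSet a 1 d
  to modulus                  = in-range (<-trans z<s 1<a) ≤-refl
  to unit                     = in-range z<s (<⇒≤ 1<a)
  to (lower {w} 0<w w<a _)    = subst (EuclidSet a 1) (sym (res≡id w<a)) (in-range 0<w (<⇒≤ w<a))
  to (upper {w} 0<w w<a _)    = subst (EuclidSet a 1) (cong (a ∸_) (sym (res≡id w<a))) (in-range (m<n⇒0<n∸m w<a) (m∸n≤m a w))
  from : ∀ {d} → EuclidSet a 1 d → RecordDistance a res d
  from (here zero _ refl) = modulus
  from (here (suc z) z<a/1 refl) =
    subst (RecordDistance a res) (cong (a ∸_) (trans (res≡id w<a) (sym (*-identityʳ (suc z))))) (upper z<s w<a up)
    where
    w<a : suc z < a
    w<a = subst (suc z <_) (n/1≡n a) z<a/1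
    up : UpperRecord res (suc z)
    up v _ v<w = subst₂ _<_ (sym (res≡id (<-trans v<w w<a))) (sym (res≡id w<a)) v<w
  from {d} (there e) = contradiction (subst (λ r → EuclidSet 1 r d) (n%1≡0 a) e) euclid-set-1-0

record-distance⇔euclid-set : ∀ a b .{{_ : NonZero a}} → Acc _<_ b → Coprime a b → 0 < b → b < a →
                             ∀ {d} → RecordDistance a (Residues.res a b) d ⇔ EuclidSet a b d
record-distance⇔euclid-set a 1 _ _ _ 1<a = record-distance⇔euclid-set-1 a 1<a
record-distance⇔euclid-set a b@(suc (suc _)) (acc rs) coprime _ b<a =
  euclid-set-unfold a b ⇔-∘ ((⇔-id _ ⊎-⇔ IH) ⇔-∘ euclid-step)
  where
  open EuclidStep a b coprime (s≤s z<s) b<a using (euclid-step)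
  IH : ∀ {d} → RecordDistance b (Residues.res b (a % b)) d ⇔ EuclidSet b (a % b) d
  IH = record-distance⇔euclid-set b (a % b) (rs (m%n<n a b)) (coprime-% coprime) (coprime⇒%>0 coprime (s≤s z<s)) (m%n<n a b)

φ+m+n≡1+m*n : ∀ m n .{{_ : NonZero m}} .{{_ : NonZero n}} → φ m n + m + n ≡ suc (m * n)
φ+m+n≡1+m*n (suc m) (suc n) = solve 2 (λ m n → m :* n :+ (con 1 :+ m) :+ (con 1 :+ n) := con 1 :+ (con 1 :+ m) :* (con 1 :+ n)) refl m n

*q+*p-reduce : ∀ p q .{{_ : NonZero p}} i j → i * q + j * p ≡ i % p * q + (i / p * q + j) * p
*q+*p-reduce p q i j = begin
  i * q + j * p                   ≡⟨ cong (λ k → k * q + j * p) (m≡m%n+[m/n]*n i p) ⟩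
  (i % p + i / p * p) * q + j * p ≡⟨ solve 5 (λ r d p q j → (r :+ d :* p) :* q :+ j :* p := r :* q :+ (d :* q :+ j) :* p) refl (i % p) (i / p) p q j ⟩
  i % p * q + (i / p * q + j) * p ∎
  where open ≡-Reasoning

bezout-multiple : ∀ {p} n p′ x y q → p ≡ suc p′ → 1 + y * q ≡ x * p → (n * p′ * y) * q + n * p ≡ n + (n * p′ * x) * p
bezout-multiple n p′ x y q refl eq = begin
  (n * p′ * y) * q + n * suc p′ ≡⟨ solve 4 (λ n p′ y q → (n :* p′ :* y) :* q :+ n :* (con 1 :+ p′) := n :+ n :* p′ :* (con 1 :+ y :* q)) refl n p′ y q ⟩
  n + n * p′ * (1 + y * q)      ≡⟨ cong (λ t → n + n * p′ * t) eq ⟩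
  n + n * p′ * (x * suc p′)     ≡⟨ cong (n +_) (*-assoc (n * p′) x (suc p′)) ⟨
  n + (n * p′ * x) * suc p′     ∎
  where open ≡-Reasoning

module NumericalSemigroup (p q : ℕ) .{{_ : NonZero p}} (1<p : 1 < p) (p<q : p < q) (coprime : Coprime p q) where

  instance
    q-nonZero : NonZero q
    q-nonZero = >-nonZero (<-trans (<-trans z<s 1<p) p<q)

  pred-p<p : pred p < p
  pred-p<p = subst (pred p <_) (suc-pred p) ≤-refl

  0<pred-p : 0 < pred p
  0<pred-p = ≤-pred (subst (2 ≤_) (sym (suc-pred p)) 1<p)

  F : ℕ
  F = φ p q ∸ 1

  1+F≡φ : suc F ≡ φ p q
  1+F≡φ = suc-pred (φ p q) {{>-nonZero φ>0}}
    where
    φ>0 : 0 < φ p q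
    φ>0 = *-mono-≤ (∸-monoˡ-≤ 1 1<p) (∸-monoˡ-≤ 1 (<-trans 1<p p<q))

  F+p+q≡p*q : F + p + q ≡ p * q
  F+p+q≡p*q = suc-injective (trans (cong (λ t → t + p + q) 1+F≡φ) (φ+m+n≡1+m*n p q))

  canonical : ∀ {n} → InSG p q n → ∃ λ i → ∃ λ j → i < p × i * q + j * p ≡ n
  canonical (i , j , eq) = i % p , i / p * q + j , m%n<n i p , trans (sym (*q+*p-reduce p q i j)) eq

  bezout-representation : ∀ n → ∃ λ i → ∃ λ K → ∃ λ L → i * q + K * p ≡ n + L * p
  bezout-representation n with coprime-Bézout coprime
  ... | Bézout.+- x y eq = n * pred p * y , n , n * pred p * x , bezout-multiple n (pred p) x y q (sym (suc-pred p)) eq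
  ... | Bézout.-+ x y eq = n * y , 0 , n * x , (begin
    n * y * q + 0 * p ≡⟨ +-identityʳ (n * y * q) ⟩
    n * y * q         ≡⟨ *-assoc n y q ⟩
    n * (y * q)       ≡⟨ cong (n *_) eq ⟨
    n * (1 + x * p)   ≡⟨ solve 3 (λ n x p → n :* (con 1 :+ x :* p) := n :+ n :* x :* p) refl n x p ⟩
    n + n * x * p     ∎)
    where open ≡-Reasoning

  in-or-below : ∀ n → ∃ λ i → i < p × ((∃ λ j → i * q + j * p ≡ n) ⊎ (∃ λ M → i * q ≡ n + suc M * p))
  in-or-below n with i , K , L , eq ← bezout-representation n = i % p , m%n<n i p , by-cases (≤-<-connex L K′)
    where
    K′ : ℕ
    K′ = i / p * q + K
    eq′ : i % p * q + K′ * p ≡ n + L * p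
    eq′ = trans (sym (*q+*p-reduce p q i K)) eq
    by-cases : L ≤ K′ ⊎ K′ < L → (∃ λ j → i % p * q + j * p ≡ n) ⊎ (∃ λ M → i % p * q ≡ n + suc M * p)
    by-cases (inj₁ L≤K′) with j , L+j≡K′ ← m≤n⇒∃[o]m+o≡n L≤K′ = inj₁ (j , +-cancelʳ-≡ (L * p) _ _ (begin
      i % p * q + j * p + L * p ≡⟨ solve 4 (λ a j L p → a :+ j :* p :+ L :* p := a :+ (L :+ j) :* p) refl (i % p * q) j L p ⟩
      i % p * q + (L + j) * p   ≡⟨ cong (λ k → i % p * q + k * p) L+j≡K′ ⟩
      i % p * q + K′ * p        ≡⟨ eq′ ⟩
      n + L * p                 ∎))
      where open ≡-Reasoning
    by-cases (inj₂ K′<L) with M , 1+K′+M≡L ← m≤n⇒∃[o]m+o≡n K′<L = inj₂ (M , +-cancelʳ-≡ (K′ * p) _ _ (begin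
      i % p * q + K′ * p     ≡⟨ eq′ ⟩
      n + L * p              ≡⟨ cong (λ k → n + k * p) 1+K′+M≡L ⟨
      n + (suc K′ + M) * p   ≡⟨ solve 4 (λ n K M p → n :+ (con 1 :+ K :+ M) :* p := n :+ (con 1 :+ M) :* p :+ K :* p) refl n K′ M p ⟩
      n + suc M * p + K′ * p ∎))
      where open ≡-Reasoning

  -- m + n = F would give (i + i′ + 1) q + (j + j′ + 1) p = p q, forcing p ∣ i + i′ + 1.
  sum≢F : ∀ {m n} → InSG p q m → InSG p q n → m + n ≢ F
  sum≢F {m} {n} (i , j , m≡) (i′ , j′ , n≡) m+n≡F = <-irrefl refl (begin-strict
    p * q         ≤⟨ *-monoˡ-≤ q (∣⇒≤ p∣s) ⟩
    s * q         <⟨ m<n+m (s * q) (≤-trans (<-trans z<s 1<p) (m≤m+n p ((j + j′) * p))) ⟩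
    t * p + s * q ≡⟨ total ⟩
    p * q         ∎)
    where
    open ≤-Reasoning
    s t : ℕ
    s = suc (i + i′)
    t = suc (j + j′)
    total : t * p + s * q ≡ p * q
    total = begin-equality
      t * p + s * q                               ≡⟨ solve 6 (λ i j i′ j′ p q → (con 1 :+ (j :+ j′)) :* p :+ (con 1 :+ (i :+ i′)) :* q := (i :* q :+ j :* p) :+ (i′ :* q :+ j′ :* p) :+ p :+ q) refl i j i′ j′ p q ⟩
      (i * q + j * p) + (i′ * q + j′ * p) + p + q ≡⟨ cong₂ (λ x y → x + y + p + q) m≡ n≡ ⟩
      m + n + p + q                               ≡⟨ cong (λ x → x + p + q) m+n≡F ⟩
      F + p + q                                   ≡⟨ F+p+q≡p*q ⟩
      p * q                                       ∎
    p∣s : p ∣ s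
    p∣s = coprime-divisor coprime (subst (p ∣_) (*-comm s q) (∣m+n∣m⇒∣n (subst (p ∣_) (sym total) (m∣m*n q)) (n∣m*n t)))

  -- If n ∉ ⟨p,q⟩ then i q = n + (M + 1) p for some i < p, and (p − 1 − i) q + M p complements n.
  in-or-complement : ∀ n → InSG p q n ⊎ ∃ λ m → InSG p q m × m + n ≡ F
  in-or-complement n with in-or-below n
  ... | i , _ , inj₁ (j , eq) = inj₁ (i , j , eq)
  ... | i , i<p , inj₂ (M , iq≡) with e , 1+i+e≡p ← m≤n⇒∃[o]m+o≡n i<p =
    inj₂ (e * q + M * p , (e , M , refl) , +-cancelʳ-≡ (p + q) _ _ (begin
      e * q + M * p + n + (p + q) ≡⟨ solve 5 (λ e q M p n → e :* q :+ M :* p :+ n :+ (p :+ q) := e :* q :+ q :+ (n :+ (con 1 :+ M) :* p)) refl e q M p n ⟩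
      e * q + q + (n + suc M * p) ≡⟨ cong (e * q + q +_) iq≡ ⟨
      e * q + q + i * q           ≡⟨ solve 3 (λ e q i → e :* q :+ q :+ i :* q := (con 1 :+ i :+ e) :* q) refl e q i ⟩
      (suc i + e) * q             ≡⟨ cong (_* q) 1+i+e≡p ⟩
      p * q                       ≡⟨ F+p+q≡p*q ⟨
      F + p + q                   ≡⟨ +-assoc F p q ⟩
      F + (p + q)                 ∎))
    where open ≡-Reasoning

  F∉ : ¬ InSG p q F
  F∉ F∈ = sum≢F F∈ (0 , 0 , refl) (+-identityʳ F)

  >F⇒∈ : ∀ {n} → F < n → InSG p q n
  >F⇒∈ {n} F<n with in-or-complement n
  ... | inj₁ n∈ = n∈
  ... | inj₂ (m , _ , m+n≡F) = contradiction (subst (n ≤_) m+n≡F (m≤n+m n m)) (<⇒≱ F<n)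

  ∈∧<p⇒≡0 : ∀ {n} → InSG p q n → n < p → n ≡ 0
  ∈∧<p⇒≡0 (zero , zero , eq) _ = sym eq
  ∈∧<p⇒≡0 {n} (zero , suc j , eq) n<p = contradiction (subst (p ≤_) eq (m≤m+n p (j * p))) (<⇒≱ n<p)
  ∈∧<p⇒≡0 {n} (suc i , j , eq) n<p =
    contradiction (subst (q ≤_) eq (≤-trans (m≤m+n q (i * q)) (m≤m+n _ (j * p)))) (<⇒≱ (<-trans n<p p<q))

  complement-of-small : ∀ {k} → 0 < k → k < p → ∃ λ m → InSG p q m × m + k ≡ F
  complement-of-small {k} 0<k k<p with in-or-complement k
  ... | inj₁ k∈ = contradiction (∈∧<p⇒≡0 k∈ k<p) (>⇒≢ 0<k)
  ... | inj₂ c  = c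

[N∸a]∸[N∸b]≡b∸a : ∀ {N a b} → a ≤ b → b ≤ N → (N ∸ a) ∸ (N ∸ b) ≡ b ∸ a
[N∸a]∸[N∸b]≡b∸a {N} {a} {b} a≤b b≤N = begin
  (N ∸ a) ∸ (N ∸ b)           ≡⟨ cong (λ n → (n ∸ a) ∸ (N ∸ b)) (m∸n+n≡m b≤N) ⟨
  (N ∸ b + b ∸ a) ∸ (N ∸ b)   ≡⟨ cong (_∸ (N ∸ b)) (+-∸-assoc (N ∸ b) a≤b) ⟩
  (N ∸ b + (b ∸ a)) ∸ (N ∸ b) ≡⟨ m+n∸m≡n (N ∸ b) (b ∸ a) ⟩
  b ∸ a                       ∎
  where open ≡-Reasoning

consecutive-reflect : ∀ {P Q : ℕ → Set} {N a b} → b ≤ N →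
  (∀ {x} → x ≤ N → P x → Q (N ∸ x)) → (∀ {y} → y ≤ N → Q y → P (N ∸ y)) →
  Consecutive P a b → Consecutive Q (N ∸ b) (N ∸ a)
consecutive-reflect {P} {Q} {N} {a} {b} b≤N P⇒Q Q⇒P (Pa , Pb , a<b , none) =
  P⇒Q b≤N Pb , P⇒Q (≤-trans (<⇒≤ a<b) b≤N) Pa , ∸-monoʳ-< a<b b≤N , none′
  where
  none′ : ∀ c → Q c → N ∸ b < c → c < N ∸ a → ⊥
  none′ c Qc lo hi = none (N ∸ c) (Q⇒P c≤N Qc)
    (∸-cancelʳ-< (subst (_< N ∸ a) (sym (m∸[m∸n]≡n c≤N)) hi))
    (∸-cancelʳ-< (subst (N ∸ b <_) (sym (m∸[m∸n]≡n c≤N)) lo))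
    where
    c≤N : c ≤ N
    c≤N = ≤-trans (<⇒≤ hi) (m∸n≤m N a)

neighbour-∈ : ∀ {p n} → InSG p (suc p) (suc n) → InSG p (suc p) n ⊎ InSG p (suc p) (suc (suc n))
neighbour-∈ {p} {n} (suc i , j , eq) = inj₁ (i , suc j , suc-injective (begin
  suc (i * suc p + suc j * p) ≡⟨ solve 3 (λ i j p → con 1 :+ (i :* (con 1 :+ p) :+ (con 1 :+ j) :* p) := (con 1 :+ i) :* (con 1 :+ p) :+ j :* p) refl i j p ⟩
  suc i * suc p + j * p       ≡⟨ eq ⟩
  suc n                       ∎))
  where open ≡-Reasoning
neighbour-∈ {p} {n} (zero , suc j , eq) = inj₂ (1 , j , (begin
  1 * suc p + j * p           ≡⟨ solve 2 (λ j p → con 1 :* (con 1 :+ p) :+ j :* p := con 1 :+ (con 0 :* (con 1 :+ p) :+ (con 1 :+ j) :* p)) refl j p ⟩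
  suc (0 * suc p + suc j * p) ≡⟨ cong suc eq ⟩
  suc (suc n)                 ∎))
  where open ≡-Reasoning

module GapDifferences (p q : ℕ) .{{_ : NonZero p}} (1<p : 1 < p) (p<q : p < q) (coprime : Coprime p q) where

  open NumericalSemigroup p q 1<p p<q coprime

  F≤φ : F ≤ φ p q
  F≤φ = subst (F ≤_) 1+F≡φ (n≤1+n F)

  gap≤F : ∀ {n} → IsGap p q n → n ≤ F
  gap≤F {n} (_ , n∉) = ≮⇒≥ (λ F<n → n∉ (>F⇒∈ F<n))

  ∈⇒reflection-gap : ∀ {x} → x ≤ F → InS p q x → IsGap p q (F ∸ x)
  ∈⇒reflection-gap {x} x≤F (x∈ , _) = m<n⇒0<n∸m x<F , λ F∸x∈ → sum≢F x∈ F∸x∈ (m+[n∸m]≡n x≤F)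
    where
    x<F : x < F
    x<F = ≤∧≢⇒< x≤F (λ { refl → F∉ x∈ })

  gap⇒reflection-∈ : ∀ {y} → y ≤ F → IsGap p q y → InS p q (F ∸ y)
  gap⇒reflection-∈ {y} y≤F (_ , y∉) with in-or-complement y
  ... | inj₁ y∈ = contradiction y∈ y∉
  ... | inj₂ (m , m∈ , m+y≡F) = subst (InS p q) (sym F∸y≡m) (m∈ , ≤-trans (m≤m+n m y) (≤-trans (≤-reflexive m+y≡F) F≤φ))
    where
    F∸y≡m : F ∸ y ≡ m
    F∸y≡m = trans (cong (_∸ y) (sym m+y≡F)) (m+n∸n≡m m y)

  private
    F-predecessor : ∃ λ m → InSG p q m × m + 1 ≡ F
    F-predecessor = complement-of-small z<s 1<p

  F₋₁ : ℕ
  F₋₁ = proj₁ F-predecessor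

  F₋₁+1≡F : F₋₁ + 1 ≡ F
  F₋₁+1≡F = proj₂ (proj₂ F-predecessor)

  F₋₁∈ : InS p q F₋₁
  F₋₁∈ = proj₁ (proj₂ F-predecessor) , ≤-trans (m≤m+n F₋₁ 1) (≤-trans (≤-reflexive F₋₁+1≡F) F≤φ)

  1+F∸F₋₁≡2 : suc F ∸ F₋₁ ≡ 2
  1+F∸F₋₁≡2 = trans (cong (λ n → suc n ∸ F₋₁) (trans (sym F₋₁+1≡F) (+-comm F₋₁ 1))) (m+n∸n≡m 2 F₋₁)

  F₋₁<F : F₋₁ < F
  F₋₁<F = subst (F₋₁ <_) (trans (+-comm 1 F₋₁) F₋₁+1≡F) ≤-refl

  F₋₁<⇒F≤ : ∀ {c} → F₋₁ < c → F ≤ c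
  F₋₁<⇒F≤ {c} = subst (_≤ c) (trans (+-comm 1 F₋₁) F₋₁+1≡F)

  consecutive-F₋₁-φ : Consecutive (InS p q) F₋₁ (suc F)
  consecutive-F₋₁-φ = F₋₁∈ , (>F⇒∈ ≤-refl , ≤-reflexive 1+F≡φ) , <-trans F₋₁<F ≤-refl , none
    where
    none : ∀ c → InS p q c → F₋₁ < c → c < suc F → ⊥
    none c (c∈ , _) F₋₁<c c<1+F = F∉ (subst (InSG p q) (≤-antisym (≤-pred c<1+F) (F₋₁<⇒F≤ F₋₁<c)) c∈)

  consecutive-φ⇒F₋₁ : ∀ {a} → Consecutive (InS p q) a (suc F) → a ≡ F₋₁
  consecutive-φ⇒F₋₁ {a} (a∈ , _ , a<1+F , none) with <-cmp a F₋₁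
  ... | tri≈ _ a≡F₋₁ _ = a≡F₋₁
  ... | tri< a<F₋₁ _ _ = ⊥-elim (none F₋₁ F₋₁∈ a<F₋₁ (<-trans F₋₁<F ≤-refl))
  ... | tri> _ _ F₋₁<a = ⊥-elim (F∉ (subst (InSG p q) a≡F (proj₁ a∈)))
    where
    a≡F : a ≡ F
    a≡F = ≤-antisym (≤-pred a<1+F) (F₋₁<⇒F≤ F₋₁<a)

  SΔ⇒NΔ⊎2 : ∀ {d} → SΔ p q d → NΔ p q d ⊎ d ≡ 2
  SΔ⇒NΔ⊎2 {d} (a , b , ab@(_ , (b∈ , b≤φ) , a<b , _) , d≡b∸a) with b <? F
  ... | yes b<F = inj₁ (F ∸ b , F ∸ a , consecutive-reflect (<⇒≤ b<F) ∈⇒reflection-gap gap⇒reflection-∈ ab ,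
                        trans d≡b∸a (sym ([N∸a]∸[N∸b]≡b∸a (<⇒≤ a<b) (<⇒≤ b<F))))
  ... | no b≮F = inj₂ (begin
    d           ≡⟨ d≡b∸a ⟩
    b ∸ a       ≡⟨ cong₂ _∸_ b≡1+F (consecutive-φ⇒F₋₁ (subst (Consecutive (InS p q) a) b≡1+F ab)) ⟩
    suc F ∸ F₋₁ ≡⟨ 1+F∸F₋₁≡2 ⟩
    2           ∎)
    where
    open ≡-Reasoning
    b≡1+F : b ≡ suc F
    b≡1+F = ≤-antisym (subst (b ≤_) (sym 1+F≡φ) b≤φ) (≤∧≢⇒< (≮⇒≥ b≮F) (λ F≡b → F∉ (subst (InSG p q) (sym F≡b) b∈)))

  NΔ⇒SΔ : ∀ {d} → NΔ p q d → SΔ p q d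
  NΔ⇒SΔ (g , h , gh@(_ , h-gap , g<h , _) , d≡h∸g) =
    F ∸ h , F ∸ g , consecutive-reflect (gap≤F h-gap) gap⇒reflection-∈ ∈⇒reflection-gap gh ,
    trans d≡h∸g (sym ([N∸a]∸[N∸b]≡b∸a (<⇒≤ g<h) (gap≤F h-gap)))

  2∈SΔ : SΔ p q 2
  2∈SΔ = F₋₁ , suc F , consecutive-F₋₁-φ , sym 1+F∸F₋₁≡2

  1+p∉ : q ≢ suc p → ¬ InSG p q (suc p)
  1+p∉ q≢1+p (zero , j , eq) = <⇒≱ 1<p (∣⇒≤ (∣m+n∣m⇒∣n (subst (p ∣_) (trans eq (+-comm 1 p)) (n∣m*n j)) ∣-refl))
  1+p∉ q≢1+p (suc i , j , eq) = q≢1+p (≤-antisym (subst (q ≤_) eq (≤-trans (m≤m+n q (i * q)) (m≤m+n _ (j * p)))) p<q)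

  2∈NΔ : q ≢ suc p → NΔ p q 2
  2∈NΔ q≢1+p = pred p , suc p , (pred-gap , (z<s , 1+p∉ q≢1+p) , <-trans pred-p<p (n<1+n p) , none) , sym 1+p∸pred≡2
    where
    pred-gap : IsGap p q (pred p)
    pred-gap = 0<pred-p , λ pred∈ → >⇒≢ 0<pred-p (∈∧<p⇒≡0 pred∈ pred-p<p)
    none : ∀ c → IsGap p q c → pred p < c → c < suc p → ⊥
    none c (_ , c∉) pred<c c<1+p = c∉ (subst (InSG p q) (≤-antisym (subst (_≤ c) (suc-pred p) pred<c) (≤-pred c<1+p)) (0 , 1 , +-identityʳ p))
    1+p∸pred≡2 : suc p ∸ pred p ≡ 2
    1+p∸pred≡2 = trans (cong (λ n → suc n ∸ pred p) (sym (suc-pred p))) (m+n∸n≡m 2 (pred p))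

  2∉NΔ : q ≡ suc p → ¬ NΔ p q 2
  2∉NΔ q≡1+p (g , h , ((_ , g∉) , (_ , h∉) , g<h , none) , 2≡h∸g) = none (suc g) (z<s , 1+g∉) ≤-refl 1+g<h
    where
    h≡2+g : h ≡ suc (suc g)
    h≡2+g = trans (sym (m+[n∸m]≡n (<⇒≤ g<h))) (trans (cong (g +_) (sym 2≡h∸g)) (+-comm g 2))
    1+g<h : suc g < h
    1+g<h = subst (suc g <_) (sym h≡2+g) ≤-refl
    1+g∉ : ¬ InSG p q (suc g)
    1+g∉ 1+g∈ with neighbour-∈ (subst (λ r → InSG p r (suc g)) q≡1+p 1+g∈)
    ... | inj₁ g∈   = g∉ (subst (λ r → InSG p r g) (sym q≡1+p) g∈)
    ... | inj₂ 2+g∈ = h∉ (subst₂ (InSG p) (sym q≡1+p) (sym h≡2+g) 2+g∈)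

module RecordDifferences (p q : ℕ) .{{_ : NonZero p}} (3≤p : 3 ≤ p) (p<q : p < q) (coprime : Coprime p q) where

  private
    1<p : 1 < p
    1<p = <-trans (n<1+n 1) 3≤p
    0<p : 0 < p
    0<p = <-trans z<s 1<p

  open NumericalSemigroup p q 1<p p<q coprime
  open Residues p q using (quo-res; res-bound; res-unique; res-shift; res-shift-≤) renaming (res to X; quo to K)

  X>0 : ∀ {v} → 0 < v → v < p → 0 < X v
  X>0 = Residues.res>0 p q coprime

  X0≡0 : X 0 ≡ 0
  X0≡0 = m<n⇒m%n≡m 0<p

  lower-record-below : ∀ {w i} → LowerRecord X w → i ≤ w → X i < X w → i ≡ 0
  lower-record-below {i = zero} _ _ _ = refl
  lower-record-below {i = suc i} low i≤w Xi<Xw with m≤n⇒m<n∨m≡n i≤w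
  ... | inj₁ i<w  = contradiction (low _ z<s i<w) (<-asym Xi<Xw)
  ... | inj₂ refl = contradiction Xi<Xw (<-irrefl refl)

  upper-record-max : ∀ {w i} → UpperRecord X w → i ≤ w → X i ≤ X w
  upper-record-max {w} {zero} _ _ = subst (_≤ X w) (sym X0≡0) z≤n
  upper-record-max {i = suc i} up i≤w with m≤n⇒m<n∨m≡n i≤w
  ... | inj₁ i<w  = <⇒≤ (up _ z<s i<w)
  ... | inj₂ refl = ≤-refl

  SΔ-intro : ∀ {a b} → InSG p q a → InSG p q b → a < b → a < φ p q → (∀ c → InSG p q c → a < c → c < b → ⊥) → SΔ p q (b ∸ a)
  SΔ-intro {a} {b} a∈ b∈ a<b a<φ none = a , b , ((a∈ , <⇒≤ a<φ) , (b∈ , b≤φ) , a<b , λ c c∈S → none c (proj₁ c∈S)) , refl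
    where
    b≤φ : b ≤ φ p q
    b≤φ = ≮⇒≥ (λ φ<b → none (φ p q) (>F⇒∈ (subst (F <_) 1+F≡φ ≤-refl)) a<φ φ<b)

  0<φ : 0 < φ p q
  0<φ = subst (0 <_) 1+F≡φ z<s

  p∈SΔ : SΔ p q p
  p∈SΔ = SΔ-intro (0 , 0 , refl) (0 , 1 , +-identityʳ p) 0<p 0<φ (λ c c∈ 0<c c<p → >⇒≢ 0<c (∈∧<p⇒≡0 c∈ c<p))

  1∈SΔ : SΔ p q 1
  1∈SΔ = pair (complement-of-small z<s 3≤p) (complement-of-small z<s 1<p)
    where
    pair : ∃ (λ m → InSG p q m × m + 2 ≡ F) → ∃ (λ m′ → InSG p q m′ × m′ + 1 ≡ F) → SΔ p q 1
    pair (m , m∈ , m+2≡F) (m′ , m′∈ , m′+1≡F) =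
      subst (SΔ p q) (trans (cong (_∸ m) m′≡1+m) (m+n∸n≡m 1 m)) (SΔ-intro m∈ m′∈ m<m′ m<φ none)
      where
      m′≡1+m : m′ ≡ suc m
      m′≡1+m = +-cancelʳ-≡ 1 m′ (suc m) (trans m′+1≡F (trans (sym m+2≡F) (+-suc m 1)))
      m<m′ : m < m′
      m<m′ = subst (m <_) (sym m′≡1+m) ≤-refl
      m<φ : m < φ p q
      m<φ = <-≤-trans (subst (m <_) m+2≡F (m<m+n m z<s)) (subst (F ≤_) 1+F≡φ (n≤1+n F))
      none : ∀ c → InSG p q c → m < c → c < m′ → ⊥
      none c _ m<c c<m′ = <⇒≱ (subst (c <_) m′≡1+m c<m′) m<c

  column-form : ∀ {c} → InSG p q c → ∃ λ i → ∃ λ j → i < p × i * q ≤ c × (K i + j) * p + X i ≡ c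
  column-form c∈ with i , j , i<p , eq ← canonical c∈ =
    i , j , i<p , ≤-trans (m≤m+n (i * q) (j * p)) (≤-reflexive eq) , trans (sym (res-shift 0 i j)) eq

  w*q<φ : ∀ {w} → suc w < p → w * q < φ p q
  w*q<φ {w} 1+w<p = begin-strict
    w * q            ≡⟨ cong (w *_) (suc-pred q) ⟨
    w * suc (pred q) ≡⟨ *-suc w (pred q) ⟩
    w + w * pred q   <⟨ +-monoˡ-< (w * pred q) w<pred-q ⟩
    suc w * pred q   ≤⟨ *-monoˡ-≤ (pred q) (≤-pred (subst (suc (suc w) ≤_) (sym (suc-pred p)) 1+w<p)) ⟩
    pred p * pred q  ∎
    where
    open ≤-Reasoning
    w<pred-q : w < pred q
    w<pred-q = ≤-pred (subst (suc (suc w) ≤_) (sym (suc-pred q)) (<-trans 1+w<p p<q))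

  lower-pair : ∀ {w} → 0 < w → suc w < p → LowerRecord X w → SΔ p q (X w)
  lower-pair {w} 0<w 1+w<p low =
    subst (SΔ p q) (trans (cong (_∸ K w * p) (quo-res w)) (m+n∸m≡n (K w * p) (X w)))
      (SΔ-intro (0 , K w , refl) (w , 0 , +-identityʳ (w * q)) a<b (<-trans a<b (w*q<φ 1+w<p)) none)
    where
    a<b : K w * p < w * q
    a<b = subst (K w * p <_) (sym (quo-res w)) (m<m+n (K w * p) (X>0 0<w (<-trans (n<1+n w) 1+w<p)))
    none : ∀ c → InSG p q c → K w * p < c → c < w * q → ⊥
    none c c∈ a<c c<b = column-case (column-form c∈)
      where
      column-case : (∃ λ i → ∃ λ j → i < p × i * q ≤ c × (K i + j) * p + X i ≡ c) → ⊥
      column-case (i , j , _ , iq≤c , c≡) with i <? w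
      ... | no i≮w = <⇒≱ c<b (≤-trans (*-monoˡ-≤ q (≮⇒≥ i≮w)) iq≤c)
      ... | yes i<w with *+<*+⇒lex< (K i + j) (K w) (res-bound i) (res-bound w) (subst₂ _<_ (sym c≡) (quo-res w) c<b)
      ...   | inj₁ Ki+j<Kw = <⇒≱ Ki+j<Kw (*≤*+⇒≤ (K w) (K i + j) (res-bound i) (<⇒≤ (subst (K w * p <_) (sym c≡) a<c)))
      ...   | inj₂ (Ki+j≡Kw , Xi<Xw) = <-irrefl c≡Kw*p a<c
        where
        c≡Kw*p : K w * p ≡ c
        c≡Kw*p = begin
          K w * p             ≡⟨ +-identityʳ (K w * p) ⟨
          K w * p + 0         ≡⟨ cong₂ (λ k x → k * p + x) (sym Ki+j≡Kw) (trans (sym X0≡0) (cong X (sym (lower-record-below low (<⇒≤ i<w) Xi<Xw)))) ⟩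
          (K i + j) * p + X i ≡⟨ c≡ ⟩
          c                   ∎
          where open ≡-Reasoning

  upper-pair : ∀ {w} → 0 < w → suc w < p → UpperRecord X w → SΔ p q (p ∸ X w)
  upper-pair {w} 0<w 1+w<p up =
    subst (SΔ p q) b∸a≡p∸Xw (SΔ-intro (w , 0 , +-identityʳ (w * q)) (0 , suc (K w) , refl) a<b (w*q<φ 1+w<p) none)
    where
    b∸a≡p∸Xw : suc (K w) * p ∸ w * q ≡ p ∸ X w
    b∸a≡p∸Xw = trans (cong₂ _∸_ (+-comm p (K w * p)) (quo-res w)) ([m+n]∸[m+o]≡n∸o (K w * p) p (X w))
    a<b : w * q < suc (K w) * p
    a<b = subst₂ _<_ (sym (quo-res w)) (+-comm (K w * p) p) (+-monoʳ-< (K w * p) (res-bound w))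
    none : ∀ c → InSG p q c → w * q < c → c < suc (K w) * p → ⊥
    none c c∈ a<c c<b = column-case (column-form c∈)
      where
      column-case : (∃ λ i → ∃ λ j → i < p × i * q ≤ c × (K i + j) * p + X i ≡ c) → ⊥
      column-case (i , j , _ , iq≤c , c≡) with i ≤? w
      ... | no i≰w = <⇒≱ c<b (begin
        p + K w * p ≤⟨ +-mono-≤ (<⇒≤ p<q) (subst (K w * p ≤_) (sym (quo-res w)) (m≤m+n (K w * p) (X w))) ⟩
        q + w * q   ≤⟨ *-monoˡ-≤ q (≰⇒> i≰w) ⟩
        i * q       ≤⟨ iq≤c ⟩
        c           ∎)
        where open ≤-Reasoning
      ... | yes i≤w with *+<*+⇒lex< (K w) (K i + j) (res-bound w) (res-bound i) (subst₂ _<_ (quo-res w) (sym c≡) a<c)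
      ...   | inj₁ Kw<Ki+j = <⇒≱ (*+<*⇒< (K i + j) (suc (K w)) (X i) (subst (_< suc (K w) * p) (sym c≡) c<b)) Kw<Ki+j
      ...   | inj₂ (_ , Xw<Xi) = <⇒≱ Xw<Xi (upper-record-max up i≤w)

  res-surjective : ∀ {n} → 0 < n → n < p → ∃ λ i → i < p × X i ≡ n
  res-surjective {n} 0<n n<p with in-or-below n
  ... | i , _ , inj₁ (j , eq)     = contradiction (∈∧<p⇒≡0 (i , j , eq) n<p) (>⇒≢ 0<n)
  ... | i , i<p , inj₂ (M , iq≡) = i , i<p , res-unique i (suc M) n<p (trans iq≡ (+-comm n _))

  last-lower-record : ∀ {w} → 0 < w → suc w ≡ p → LowerRecord X w → X w ≡ 1
  last-lower-record {w} 0<w 1+w≡p low with i , i<p , Xi≡1 ← res-surjective z<s 1<p =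
    ≤-antisym (subst (X w ≤_) Xi≡1 (≮⇒≥ Xi≮Xw)) (X>0 0<w (subst (w <_) 1+w≡p ≤-refl))
    where
    Xi≮Xw : ¬ X i < X w
    Xi≮Xw Xi<Xw = 0≢1+n (trans (sym X0≡0) (trans (cong X (sym (lower-record-below low i≤w Xi<Xw))) Xi≡1))
      where
      i≤w : i ≤ w
      i≤w = ≤-pred (subst (i <_) (sym 1+w≡p) i<p)

  last-upper-record : ∀ {w} → suc w ≡ p → UpperRecord X w → p ∸ X w ≡ 1
  last-upper-record {w} 1+w≡p up with i , i<p , Xi≡pred ← res-surjective 0<pred-p pred-p<p =
    trans (cong (p ∸_) Xw≡pred) (m∸[m∸n]≡n {p} {1} 0<p)
    where
    Xw≡pred : X w ≡ pred p
    Xw≡pred = ≤-antisym (≤-pred (subst (X w <_) (sym (suc-pred p)) (res-bound w)))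
                        (subst (_≤ X w) Xi≡pred (upper-record-max up (≤-pred (subst (i <_) (sym 1+w≡p) i<p))))

  record⇒SΔ : ∀ {d} → RecordDistance p X d → SΔ p q d
  record⇒SΔ modulus = p∈SΔ
  record⇒SΔ unit    = 1∈SΔ
  record⇒SΔ (lower {w} 0<w w<p low) with m≤n⇒m<n∨m≡n w<p
  ... | inj₁ 1+w<p = lower-pair 0<w 1+w<p low
  ... | inj₂ 1+w≡p = subst (SΔ p q) (sym (last-lower-record 0<w 1+w≡p low)) 1∈SΔ
  record⇒SΔ (upper {w} 0<w w<p up) with m≤n⇒m<n∨m≡n w<p
  ... | inj₁ 1+w<p = upper-pair 0<w 1+w<p up
  ... | inj₂ 1+w≡p = subst (SΔ p q) (sym (last-upper-record 1+w≡p up)) 1∈SΔ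

  module _ {a b} (ab : Consecutive (InS p q) a b) where

    private
      a<b : a < b
      a<b = proj₁ (proj₂ (proj₂ ab))

      a+d≡b : a + (b ∸ a) ≡ b
      a+d≡b = m+[n∸m]≡n (<⇒≤ a<b)

      0<d : 0 < b ∸ a
      0<d = m<n⇒0<n∸m a<b

    nothing-between : ∀ {c} → InSG p q c → a < c → c < b → ⊥
    nothing-between {c} c∈ a<c c<b = proj₂ (proj₂ (proj₂ ab)) c (c∈ , ≤-trans (<⇒≤ c<b) (proj₂ (proj₁ (proj₂ ab)))) a<c c<b

    difference≤p : b ∸ a ≤ p
    difference≤p with i , j , a≡ ← proj₁ (proj₁ ab) = ≮⇒≥ λ p<d →
      nothing-between (i , suc j , a+p≡) (m<m+n a 0<p) (subst (a + p <_) a+d≡b (+-monoʳ-< a p<d))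
      where
      a+p≡ : i * q + suc j * p ≡ a + p
      a+p≡ = trans (cong (i * q +_) (+-comm p (j * p))) (trans (sym (+-assoc (i * q) (j * p) p)) (cong (_+ p) a≡))

    same-column : ∀ {i j j′} → i * q + j * p ≡ a → i * q + j′ * p ≡ b → b ∸ a ≡ p
    same-column {i} {j} {j′} a≡ b≡ with m≤n⇒m<n∨m≡n difference≤p
    ... | inj₂ d≡p = d≡p
    ... | inj₁ d<p = contradiction (proj₂ (*+-injective j′ j 0<p d<p j′p+0≡jp+d)) (<⇒≢ 0<d)
      where
      j′p+0≡jp+d : j′ * p + 0 ≡ j * p + (b ∸ a)
      j′p+0≡jp+d = +-cancelˡ-≡ (i * q) _ _ (begin
        i * q + (j′ * p + 0)      ≡⟨ cong (i * q +_) (+-identityʳ (j′ * p)) ⟩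
        i * q + j′ * p            ≡⟨ trans b≡ (sym a+d≡b) ⟩
        a + (b ∸ a)               ≡⟨ cong (_+ (b ∸ a)) a≡ ⟨
        i * q + j * p + (b ∸ a)   ≡⟨ +-assoc (i * q) (j * p) (b ∸ a) ⟩
        i * q + (j * p + (b ∸ a)) ∎)
        where open ≡-Reasoning

    lower-column : ∀ {i j w j′} → i * q + j * p ≡ a → (i + w) * q + j′ * p ≡ b → 0 < w → i + w < p →
                   RecordDistance p X (b ∸ a)
    lower-column {i} {j} {w} {j′} a≡ b≡ 0<w i+w<p = subst (RecordDistance p X) Xw≡d (lower 0<w w<p low)
      where
      open ≡-Reasoning
      w<p : w < p
      w<p = ≤-<-trans (m≤n+m w i) i+w<p
      shifted : (K w + j′) * p + X w ≡ j * p + (b ∸ a)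
      shifted = +-cancelˡ-≡ (i * q) _ _ (begin
        i * q + ((K w + j′) * p + X w) ≡⟨ +-assoc (i * q) _ (X w) ⟨
        i * q + (K w + j′) * p + X w   ≡⟨ res-shift i w j′ ⟨
        (i + w) * q + j′ * p           ≡⟨ trans b≡ (sym a+d≡b) ⟩
        a + (b ∸ a)                    ≡⟨ cong (_+ (b ∸ a)) a≡ ⟨
        i * q + j * p + (b ∸ a)        ≡⟨ +-assoc (i * q) (j * p) (b ∸ a) ⟩
        i * q + (j * p + (b ∸ a))      ∎)
      d<p : b ∸ a < p
      d<p = ≤∧≢⇒< difference≤p λ d≡p → >⇒≢ (X>0 0<w w<p) (proj₂ (*+-injective (K w + j′) (suc j) (res-bound w) 0<p
        (trans shifted (trans (cong (j * p +_) d≡p) (trans (+-comm (j * p) p) (sym (+-identityʳ _)))))))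
      Kw+j′≡j : K w + j′ ≡ j
      Kw+j′≡j = proj₁ (*+-injective (K w + j′) j (res-bound w) d<p shifted)
      Xw≡d : X w ≡ b ∸ a
      Xw≡d = proj₂ (*+-injective (K w + j′) j (res-bound w) d<p shifted)
      low : LowerRecord X w
      low v 0<v v<w with <-cmp (X v) (X w)
      ... | tri> _ _ Xw<Xv = Xw<Xv
      ... | tri≈ _ Xv≡Xw _ = contradiction Xv≡Xw (Residues.res-injective p q coprime v<w w<p)
      ... | tri< Xv<Xw _ _ with j″ , eq ← res-shift-≤ i j′ (<⇒≤ v<w) =
        ⊥-elim (nothing-between (i + v , j″ , c≡) (m<m+n a (X>0 0<v (<-trans v<w w<p)))
                                 (subst (a + X v <_) (trans (cong (a +_) Xw≡d) a+d≡b) (+-monoʳ-< a Xv<Xw)))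
        where
        c≡ : (i + v) * q + j″ * p ≡ a + X v
        c≡ = trans eq (cong (_+ X v) (trans (cong (λ k → i * q + k * p) Kw+j′≡j) a≡))

    upper-column : ∀ {i j w j′} → (i + w) * q + j * p ≡ a → i * q + j′ * p ≡ b → 0 < w → i + w < p →
                   RecordDistance p X (b ∸ a)
    upper-column {i} {j} {w} {j′} a≡ b≡ 0<w i+w<p = subst (RecordDistance p X) (sym d≡p∸Xw) (upper 0<w w<p up)
      where
      open ≡-Reasoning
      w<p : w < p
      w<p = ≤-<-trans (m≤n+m w i) i+w<p
      T : ℕ
      T = i * q + (K w + j) * p
      a≡T+Xw : T + X w ≡ a
      a≡T+Xw = trans (sym (res-shift i w j)) a≡
      Xw+d≡p : X w + (b ∸ a) ≡ p
      Xw+d≡p = residues-sum-to-modulus (K w + j) j′ (X>0 0<w w<p) (res-bound w) difference≤p (+-cancelˡ-≡ (i * q) _ _ (begin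
        i * q + ((K w + j) * p + (X w + (b ∸ a))) ≡⟨ +-assoc (i * q) ((K w + j) * p) (X w + (b ∸ a)) ⟨
        T + (X w + (b ∸ a))                       ≡⟨ +-assoc T (X w) (b ∸ a) ⟨
        T + X w + (b ∸ a)                         ≡⟨ cong (_+ (b ∸ a)) a≡T+Xw ⟩
        a + (b ∸ a)                               ≡⟨ trans a+d≡b (sym b≡) ⟩
        i * q + j′ * p                            ∎))
      d≡p∸Xw : b ∸ a ≡ p ∸ X w
      d≡p∸Xw = trans (sym (m+n∸m≡n (X w) (b ∸ a))) (cong (_∸ X w) Xw+d≡p)
      T+p≡b : T + p ≡ b
      T+p≡b = begin
        T + p               ≡⟨ cong (T +_) Xw+d≡p ⟨
        T + (X w + (b ∸ a)) ≡⟨ +-assoc T (X w) (b ∸ a) ⟨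
        T + X w + (b ∸ a)   ≡⟨ cong (_+ (b ∸ a)) a≡T+Xw ⟩
        a + (b ∸ a)         ≡⟨ a+d≡b ⟩
        b                   ∎
      up : UpperRecord X w
      up v 0<v v<w with <-cmp (X v) (X w)
      ... | tri< Xv<Xw _ _ = Xv<Xw
      ... | tri≈ _ Xv≡Xw _ = contradiction Xv≡Xw (Residues.res-injective p q coprime v<w w<p)
      ... | tri> _ _ Xw<Xv with j″ , eq ← res-shift-≤ i j (<⇒≤ v<w) =
        ⊥-elim (nothing-between (i + v , j″ , eq) (subst (_< T + X v) a≡T+Xw (+-monoʳ-< T Xw<Xv))
                                 (subst (T + X v <_) T+p≡b (+-monoʳ-< T (res-bound v))))

    consecutive⇒record : RecordDistance p X (b ∸ a)
    consecutive⇒record with canonical (proj₁ (proj₁ ab)) | canonical (proj₁ (proj₁ (proj₂ ab)))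
    ... | i , j , i<p , a≡ | i′ , j′ , i′<p , b≡ with <-cmp i i′
    ... | tri≈ _ refl _ = subst (RecordDistance p X) (sym (same-column {i} {j} {j′} a≡ b≡)) modulus
    ... | tri< i<i′ _ _ with w , 0<w , refl ← m<n⇒∃[o]0<o×m+o≡n i<i′ = lower-column {i} {j} {w} {j′} a≡ b≡ 0<w i′<p
    ... | tri> _ _ i′<i with w , 0<w , refl ← m<n⇒∃[o]0<o×m+o≡n i′<i = upper-column {i′} {j} {w} {j′} a≡ b≡ 0<w i<p

  SΔ⇔record-distance : ∀ {d} → SΔ p q d ⇔ RecordDistance p X d
  SΔ⇔record-distance = mk⇔ (λ (a , b , ab , d≡) → subst (RecordDistance p X) (sym d≡) (consecutive⇒record ab)) record⇒SΔ

theorem1 : (p q : ℕ) .{{_ : NonZero p}} → 3 ≤ p → p < q → Coprime p q →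
    ((q ≢ suc p → ∀ d → SΔ p q d ⇔ NΔ p q d)
     × (q ≡ suc p → (∀ d → SΔ p q d ⇔ (NΔ p q d ⊎ d ≡ 2)) × ¬ NΔ p q 2))
    × (∀ d → SΔ p q d ⇔ EuclidSet p (q % p) d)
theorem1 p q 3≤p p<q coprime = (generic , consecutive) , euclidean
  where
  1<p : 1 < p
  1<p = <-trans (n<1+n 1) 3≤p
  open GapDifferences p q 1<p p<q coprime
  open RecordDifferences p q 3≤p p<q coprime using (SΔ⇔record-distance)
  generic : q ≢ suc p → ∀ d → SΔ p q d ⇔ NΔ p q d
  generic q≢1+p d = mk⇔ ([ id , (λ { refl → 2∈NΔ q≢1+p }) ] ∘ SΔ⇒NΔ⊎2) NΔ⇒SΔ
  consecutive : q ≡ suc p → (∀ d → SΔ p q d ⇔ (NΔ p q d ⊎ d ≡ 2)) × ¬ NΔ p q 2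
  consecutive q≡1+p = (λ d → mk⇔ SΔ⇒NΔ⊎2 [ NΔ⇒SΔ , (λ { refl → 2∈SΔ }) ]) , 2∉NΔ q≡1+p
  euclidean : ∀ d → SΔ p q d ⇔ EuclidSet p (q % p) d
  euclidean d = record-distance⇔euclid-set p (q % p) (<-wellFounded (q % p)) (coprime-% (Coprimality.sym coprime))
                  (coprime⇒%>0 (Coprimality.sym coprime) 1<p) (m%n<n q p)
                ⇔-∘ (record-distance-cong (res-mod p q) ⇔-∘ SΔ⇔record-distance)
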